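{- (i) There are no constants $a>0$ and $b$ such that $a\cdot\mu_d(G)+b\le\mu_d(G-e)$ holds for every connected graph $G$ and every edge $e\in E(G)$ with $G-e$ connected. (ii) There are no constants $a>0$ and $b$ such that $a\cdot\mu_d(G)+b\ge\mu_d(G-e)$ holds for every connected graph $G$ and every edge $e\in E(G)$ with $G-e$ connected.
   Context: All graphs are finite, simple and connected. For a connected graph $G$ and $X\subseteq V(G)$, two vertices $u,v$ are $X$-visible if there is a shortest $u,v$-path $P$ in $G$ with $V(P)\cap X\subseteq\{u,v\}$. A set $X\subseteq V(G)$ is a dual mutual-visibility set if every two vertices $u,v$ with $u,v\in X$ or with $u,v\in V(G)\setminus X$ are $X$-visible; the dual mutual-visibility number $\mu_d(G)$ is the maximum cardinality of a dual mutual-visibility set in $G$ (the empty set is allowed). $G-e$ denotes the graph obtained by deleting the edge $e$.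
   Formalization: The constants $a>0$ and $b$ whose existence is denied in both parts are taken in the rationals. -}

module Defs where

open import Data.Nat using (ℕ; zero; suc; _≤_)
open import Data.Fin using (Fin; _≟_)
open import Data.Fin.Subset using (Subset; _∈_; _∉_; ∣_∣)
open import Data.Bool using (Bool; true; false; _∧_; _∨_; not)
open import Data.Bool.Properties using (∨-comm)
open import Data.List using (List; []; _∷_)
open import Data.List.Relation.Unary.Unique.Propositional using (Unique)
open import Data.List.Relation.Unary.All using (All)
open import Data.Product using (Σ; _×_; _,_; ∃)
open import Data.Sum using (_⊎_)
open import Relation.Nullary.Decidable using (⌊_⌋)
open import Relation.Binary.PropositionalEquality using (_≡_; refl; cong)
import Data.Integer as ℤ
import Data.Rational as ℚ

record Graph (n : ℕ) : Set where
  field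
    adj    : Fin n → Fin n → Bool
    sym    : ∀ x y → adj x y ≡ adj y x
    irrefl : ∀ x → adj x x ≡ false
open Graph public

Adj : ∀ {n} → Graph n → Fin n → Fin n → Set
Adj G u v = adj G u v ≡ true

data Walk {n} (G : Graph n) : Fin n → Fin n → Set where
  [_]  : ∀ u → Walk G u u
  _∷⟨_⟩_ : ∀ u {w v} → Adj G u w → Walk G w v → Walk G u v

len : ∀ {n} {G : Graph n} {u v} → Walk G u v → ℕ
len [ _ ] = zero
len (_ ∷⟨ _ ⟩ p) = suc (len p)

verts : ∀ {n} {G : Graph n} {u v} → Walk G u v → List (Fin n)
verts [ u ] = u ∷ []
verts (u ∷⟨ _ ⟩ p) = u ∷ verts p

IsPath : ∀ {n} {G : Graph n} {u v} → Walk G u v → Set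
IsPath p = Unique (verts p)

IsShortestPath : ∀ {n} {G : Graph n} {u v} → Walk G u v → Set
IsShortestPath {G = G} {u} {v} p = IsPath p × (∀ (q : Walk G u v) → len p ≤ len q)

Connected : ∀ {n} → Graph n → Set
Connected G = ∀ u v → Walk G u v

isEndPair : ∀ {n} → Fin n → Fin n → Fin n → Fin n → Bool
isEndPair u v x y = (⌊ x ≟ u ⌋ ∧ ⌊ y ≟ v ⌋) ∨ (⌊ x ≟ v ⌋ ∧ ⌊ y ≟ u ⌋)

private
  isEndPair-sym : ∀ {n} (u v x y : Fin n) → isEndPair u v x y ≡ isEndPair u v y x
  isEndPair-sym u v x y with ⌊ x ≟ u ⌋ | ⌊ y ≟ v ⌋ | ⌊ x ≟ v ⌋ | ⌊ y ≟ u ⌋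
  ... | a | b | c | d =
    Relation.Binary.PropositionalEquality.trans (∨-comm (a ∧ b) (c ∧ d))
      (cong₂' (∧-comm' c d) (∧-comm' a b))
    where
      open import Data.Bool.Properties using () renaming (∧-comm to ∧-comm')
      cong₂' : ∀ {p q r s : Bool} → p ≡ q → r ≡ s → (p ∨ r) ≡ (q ∨ s)
      cong₂' refl refl = refl

removeEdge : ∀ {n} → Graph n → Fin n → Fin n → Graph n
adj (removeEdge G u v) x y = adj G x y ∧ not (isEndPair u v x y)
sym (removeEdge G u v) x y rewrite sym G x y | isEndPair-sym u v x y = refl
irrefl (removeEdge G u v) x rewrite irrefl G x = refl

Visible : ∀ {n} → Graph n → Subset n → Fin n → Fin n → Set
Visible G X u v =
  Σ (Walk G u v) λ p → IsShortestPath p ×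
    All (λ w → w ∈ X → (w ≡ u ⊎ w ≡ v)) (verts p)

IsDualMV : ∀ {n} → Graph n → Subset n → Set
IsDualMV G X = ∀ u v → ((u ∈ X × v ∈ X) ⊎ (u ∉ X × v ∉ X)) → Visible G X u v

IsMuD : ∀ {n} → Graph n → ℕ → Set
IsMuD G k = (Σ _ λ X → IsDualMV G X × ∣ X ∣ ≡ k) × (∀ X → IsDualMV G X → ∣ X ∣ ≤ k)

ℕtoℚ : ℕ → ℚ.ℚ
ℕtoℚ m = ℤ.+ m ℚ./ 1

-- For k ≥ 3 take vertices x, y, h, g and, for every i < k, a path
-- a_i b_i d_i together with the edges x a_i, h a_i, g b_i and y d_i; G₁₁ has in addition the edges xy
-- and hg, G₀₁ = G₁₁ − xy and G₀₀ = G₀₁ − hg.  Then μ_d(G₁₁) = 2, μ_d(G₀₁) = k + 1 and μ_d(G₀₀) = 1: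
-- deleting hg from G₀₁ lowers μ_d from k + 1 to 1 and deleting xy from G₁₁ raises it from 2 to k + 1,
-- which no affine bound with positive slope survives as k grows.
--
-- The lower bounds are the sets {b₀, d₀}, {x} ∪ {a_i} and {x}, checked pair by pair along routes whose
-- inner vertices avoid the set.  The upper bounds come from blocking: if every u,v-walk that is not longer
-- than a shortest one has an inner vertex in a dual mutual-visibility set Y, then exactly one of u, v lies
-- in Y.  Three pairwise blocked vertices are therefore impossible, so neither y (the only common neighbour
-- of the d_i) nor g (that of the b_i) is in Y, and x, h are not both in Y (because of the a_i).  The
-- remaining cases confine Y to {b_i, d_i} or {h} in G₁₁, to {x} ∪ {a_i} or {h} in G₀₁, and to {x} or {h}
-- in G₀₀.

module Submission where

open import Defs hiding (sym)
open import Data.Bool using (Bool; true; false; T)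
open import Data.Bool.Properties using (T-≡; T-∧; T-∨; ∧-zeroʳ; ∧-identityʳ; ¬-not) renaming (_≟_ to _≟ᵇ_)
open import Data.Empty using (⊥; ⊥-elim)
open import Data.Fin using (Fin; zero; suc)
open import Data.Fin.Properties using (any?; _≟_)
open import Data.Fin.Subset using (Subset; _∈_; _∉_; ∣_∣; ⁅_⁆; _∪_; inside; outside)
open import Data.Fin.Subset.Properties using (_∈?_; p⊆q⇒∣p∣≤∣q∣; ∣⁅x⁆∣≡1; x∈⁅x⁆; x∈p∪q⁺)
open import Data.List.Relation.Unary.All using (All; []; _∷_)
open import Data.List.Relation.Unary.All.Properties using (¬Any⇒All¬)
open import Data.List.Relation.Unary.Any using (Any; here; there)
open import Data.List.Relation.Unary.AllPairs using ([]; _∷_)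
open import Data.List.Membership.Propositional using () renaming (_∈_ to _∈ₗ_)
open import Data.Nat using (ℕ; zero; suc)
import Data.Nat as ℕ
open import Data.Product using (Σ; ∃; _×_; _,_; proj₁; proj₂)
import Data.Product as Product
open import Data.Product.Function.NonDependent.Propositional using (_×-⇔_)
open import Data.Sum using (_⊎_; inj₁; inj₂; [_,_]′)
import Data.Sum as Sum
open import Data.Sum.Function.Propositional using (_⊎-⇔_)
open import Data.Vec using ([]; _∷_; tabulate)
open import Data.Vec.Properties using ([]=⇒lookup; lookup⇒[]=; lookup∘tabulate)
open import Function using (_∘_; case_of_)
open import Function.Bundles using (_⇔_; mk⇔; Equivalence)
open import Function.Properties.Equivalence using () renaming (trans to ⇔-trans; sym to ⇔-sym)
open import Function.Related.TypeIsomorphisms using (¬-cong-⇔)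
open import Relation.Binary.PropositionalEquality using (_≡_; _≢_; refl; sym; trans; cong; cong₂; subst; subst₂)
open import Relation.Nullary using (¬_; Dec; yes; no; does)
open import Relation.Nullary.Decidable using (_×-dec_; ⌊_⌋; toWitness; fromWitness; does-⇔; dec-false)

module Walks {n} (G : Graph n) where

  open import Data.Nat using (_≤_; _<_; z≤n; s≤s)
  open import Data.Nat.Properties using (≤-refl; ≤-trans; ≤-pred; <-irrefl; <-≤-trans; ≰⇒>; m≤n⇒m≤1+n; m≤n⇒m<n∨m≡n)

  private variable
    u v w w₁ w₂ w₃ : Fin n
    X Y : Subset n

  adj-sym : Adj G u v → Adj G v u
  adj-sym {u} {v} uv = trans (Graph.sym G v u) uv

  adj-irrefl : Adj G u v → u ≢ v
  adj-irrefl {u} uu refl = case trans (sym uu) (irrefl G u) of λ ()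

  _▷_ : Walk G u v → Adj G v w → Walk G u w
  [ u ] ▷ vw = u ∷⟨ vw ⟩ [ _ ]
  (u ∷⟨ uw ⟩ p) ▷ vw = u ∷⟨ uw ⟩ (p ▷ vw)

  reverse : Walk G u v → Walk G v u
  reverse [ u ] = [ u ]
  reverse (u ∷⟨ uw ⟩ p) = reverse p ▷ adj-sym uw

  _++ᵂ_ : Walk G u v → Walk G v w → Walk G u w
  [ _ ] ++ᵂ q = q
  (u ∷⟨ uw ⟩ p) ++ᵂ q = u ∷⟨ uw ⟩ (p ++ᵂ q)

  connected-via : ∀ r → (∀ u → Walk G u r) → Connected G
  connected-via r to u v = to u ++ᵂ reverse (to v)

  Shortest : Walk G u v → Set
  Shortest {u} {v} p = ∀ (q : Walk G u v) → len p ≤ len q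

  suffix : (p : Walk G u v) → w ∈ₗ verts p → Σ (Walk G w v) λ s → len s ≤ len p
  suffix [ _ ] (here refl) = [ _ ] , z≤n
  suffix p@(_ ∷⟨ _ ⟩ _) (here refl) = p , ≤-refl
  suffix (_ ∷⟨ _ ⟩ p) (there w∈p) with suffix p w∈p
  ... | s , s≤p = s , m≤n⇒m≤1+n s≤p

  shortest⇒path : (p : Walk G u v) → Shortest p → IsPath p
  shortest⇒path [ _ ] _ = [] ∷ []
  shortest⇒path (u ∷⟨ uw ⟩ p) sh = ¬Any⇒All¬ (verts p) u∉p ∷ shortest⇒path p (λ q → ≤-pred (sh (u ∷⟨ uw ⟩ q)))
    where
    u∉p : ¬ Any (u ≡_) (verts p)
    u∉p u∈p with suffix p u∈p
    ... | s , s≤p = <-irrefl refl (<-≤-trans (s≤s s≤p) (sh s))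

  InteriorAvoids : Subset n → Walk G u v → Set
  InteriorAvoids {u} {v} X p = All (λ w → w ∈ X → w ≡ u ⊎ w ≡ v) (verts p)

  visible : (p : Walk G u v) → Shortest p → InteriorAvoids X p → Visible G X u v
  visible p sh av = p , (shortest⇒path p sh , sh) , av

  walk≤? : ∀ m u v → Dec (Σ (Walk G u v) λ q → len q ≤ m)
  walk≤? zero u v with u ≟ v
  ... | yes refl = yes ([ u ] , z≤n)
  ... | no u≢v = no λ { ([ _ ] , _) → u≢v refl ; (_ ∷⟨ _ ⟩ _ , ()) }
  walk≤? (suc m) u v with u ≟ v | any? (λ w → (adj G u w ≟ᵇ true) ×-dec walk≤? m w v)
  ... | yes refl | _ = yes ([ u ] , z≤n)
  ... | no _ | yes (w , uw , q , q≤m) = yes (u ∷⟨ uw ⟩ q , s≤s q≤m)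
  ... | no u≢v | no ∄w = no λ
    { ([ _ ] , _) → u≢v refl
    ; (_ ∷⟨ uw ⟩ q , s≤s q≤m) → ∄w (_ , uw , q , q≤m) }

  shortest-within : (p : Walk G u v) → Σ (Walk G u v) λ s → Shortest s × len s ≤ len p
  shortest-within p = go (len p) p ≤-refl
    where
    go : ∀ m (p : Walk G u v) → len p ≤ m → Σ (Walk G u v) λ s → Shortest s × len s ≤ len p
    go _ [ u ] _ = [ u ] , (λ _ → z≤n) , z≤n
    go (suc m) p@(u ∷⟨ _ ⟩ p′) (s≤s p′≤m) with walk≤? (len p′) u _
    ... | no ∄q = p , (λ q → ≰⇒> λ q≤p′ → ∄q (q , q≤p′)) , ≤-refl
    ... | yes (q , q≤p′) with go m q (≤-trans q≤p′ p′≤m)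
    ...   | s , sh , s≤q = s , sh , m≤n⇒m≤1+n (≤-trans s≤q q≤p′)

  visible-via : (p : Walk G u v) → InteriorAvoids X p →
                (∀ q → len q < len p → InteriorAvoids X q) → Visible G X u v
  visible-via p av shorter with shortest-within p
  ... | s , sh , s≤p with m≤n⇒m<n∨m≡n s≤p
  ...   | inj₁ s<p = visible s sh (shorter s s<p)
  ...   | inj₂ s≡p = visible p (λ q → subst (_≤ len q) s≡p (sh q)) av

  visible⇒avoiding-within : Visible G X u v → (p : Walk G u v) →
                            Σ (Walk G u v) λ q → len q ≤ len p × InteriorAvoids X q
  visible⇒avoiding-within (s , (_ , sh) , av) p = s , sh p , av

  private
    start : u ∈ X → u ≡ u ⊎ u ≡ v
    start _ = inj₁ refl

    end : v ∈ X → v ≡ u ⊎ v ≡ v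
    end _ = inj₂ refl

    inner : w ∉ X → w ∈ X → w ≡ u ⊎ w ≡ v
    inner w∉X w∈X = ⊥-elim (w∉X w∈X)

  avoids-below₂ : (q : Walk G u v) → len q < 2 → InteriorAvoids X q
  avoids-below₂ [ _ ] _ = start ∷ []
  avoids-below₂ (_ ∷⟨ _ ⟩ [ _ ]) _ = start ∷ end ∷ []
  avoids-below₂ (_ ∷⟨ _ ⟩ (_ ∷⟨ _ ⟩ _)) (s≤s (s≤s ()))

  avoids-below₃ : (∀ {w} → Adj G u w → Adj G w v → w ∉ X) →
                  (q : Walk G u v) → len q < 3 → InteriorAvoids X q
  avoids-below₃ _ [ _ ] _ = start ∷ []
  avoids-below₃ _ (_ ∷⟨ _ ⟩ [ _ ]) _ = start ∷ end ∷ []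
  avoids-below₃ mid (_ ∷⟨ uw ⟩ (_ ∷⟨ wv ⟩ [ _ ])) _ = start ∷ inner (mid uw wv) ∷ end ∷ []
  avoids-below₃ _ (_ ∷⟨ _ ⟩ (_ ∷⟨ _ ⟩ (_ ∷⟨ _ ⟩ _))) (s≤s (s≤s (s≤s ())))

  avoids-below₄ : (∀ {w} → Adj G u w → Adj G w v → w ∉ X) →
                  (∀ {w₁ w₂} → Adj G u w₁ → Adj G w₁ w₂ → Adj G w₂ v → w₁ ∉ X × w₂ ∉ X) →
                  (q : Walk G u v) → len q < 4 → InteriorAvoids X q
  avoids-below₄ _ _ [ _ ] _ = start ∷ []
  avoids-below₄ _ _ (_ ∷⟨ _ ⟩ [ _ ]) _ = start ∷ end ∷ []
  avoids-below₄ mid _ (_ ∷⟨ uw ⟩ (_ ∷⟨ wv ⟩ [ _ ])) _ = start ∷ inner (mid uw wv) ∷ end ∷ []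
  avoids-below₄ _ mid₂ (_ ∷⟨ h₁ ⟩ (_ ∷⟨ h₂ ⟩ (_ ∷⟨ h₃ ⟩ [ _ ]))) _ =
    start ∷ inner (proj₁ (mid₂ h₁ h₂ h₃)) ∷ inner (proj₂ (mid₂ h₁ h₂ h₃)) ∷ end ∷ []
  avoids-below₄ _ _ (_ ∷⟨ _ ⟩ (_ ∷⟨ _ ⟩ (_ ∷⟨ _ ⟩ (_ ∷⟨ _ ⟩ _)))) (s≤s (s≤s (s≤s (s≤s ()))))

  visible-refl : Visible G X u u
  visible-refl = visible-via [ _ ] (start ∷ []) λ _ ()

  visible-via₁ : Adj G u v → Visible G X u v
  visible-via₁ uv = visible-via (_ ∷⟨ uv ⟩ [ _ ]) (start ∷ end ∷ [])
    λ q q<1 → avoids-below₂ q (m≤n⇒m≤1+n q<1)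

  visible-via₂ : Adj G u w → Adj G w v → w ∉ X → Visible G X u v
  visible-via₂ uw wv w∉X = visible-via (_ ∷⟨ uw ⟩ (_ ∷⟨ wv ⟩ [ _ ]))
    (start ∷ inner w∉X ∷ end ∷ []) avoids-below₂

  visible-via₃ : (∀ {w} → Adj G u w → Adj G w v → w ∉ X) →
                 Adj G u w₁ → Adj G w₁ w₂ → Adj G w₂ v → w₁ ∉ X → w₂ ∉ X → Visible G X u v
  visible-via₃ mid h₁ h₂ h₃ w₁∉X w₂∉X = visible-via (_ ∷⟨ h₁ ⟩ (_ ∷⟨ h₂ ⟩ (_ ∷⟨ h₃ ⟩ [ _ ])))
    (start ∷ inner w₁∉X ∷ inner w₂∉X ∷ end ∷ []) (avoids-below₃ mid)

  visible-via₄ : (∀ {w} → Adj G u w → Adj G w v → w ∉ X) →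
                 (∀ {w₁ w₂} → Adj G u w₁ → Adj G w₁ w₂ → Adj G w₂ v → w₁ ∉ X × w₂ ∉ X) →
                 Adj G u w₁ → Adj G w₁ w₂ → Adj G w₂ w₃ → Adj G w₃ v →
                 w₁ ∉ X → w₂ ∉ X → w₃ ∉ X → Visible G X u v
  visible-via₄ mid mid₂ h₁ h₂ h₃ h₄ w₁∉X w₂∉X w₃∉X =
    visible-via (_ ∷⟨ h₁ ⟩ (_ ∷⟨ h₂ ⟩ (_ ∷⟨ h₃ ⟩ (_ ∷⟨ h₄ ⟩ [ _ ]))))
      (start ∷ inner w₁∉X ∷ inner w₂∉X ∷ inner w₃∉X ∷ end ∷ []) (avoids-below₄ mid mid₂)

  ¬visible₂ : u ≢ v → ¬ Adj G u v → (∀ {w} → Adj G u w → Adj G w v → w ∈ X) →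
              Adj G u w → Adj G w v → ¬ Visible G X u v
  ¬visible₂ u≢v ¬uv mid uw wv vis with visible⇒avoiding-within vis (_ ∷⟨ uw ⟩ (_ ∷⟨ wv ⟩ [ _ ]))
  ... | [ _ ] , _ = u≢v refl
  ... | (_ ∷⟨ uv ⟩ [ _ ]) , _ = ¬uv uv
  ... | (_ ∷⟨ uw′ ⟩ (_ ∷⟨ w′v ⟩ [ _ ])) , _ , _ ∷ w′-end ∷ _ =
    [ adj-irrefl uw′ ∘ sym , adj-irrefl w′v ]′ (w′-end (mid uw′ w′v))
  ... | (_ ∷⟨ _ ⟩ (_ ∷⟨ _ ⟩ (_ ∷⟨ _ ⟩ _))) , s≤s (s≤s ()) , _

  ¬visible₃ : u ≢ v → ¬ Adj G u v → (∀ {w} → Adj G u w → Adj G w v → w ∈ X) →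
              (∀ {w₁ w₂} → Adj G u w₁ → Adj G w₁ w₂ → Adj G w₂ v → w₁ ∈ X ⊎ w₂ ∈ X) →
              Adj G u w₁ → Adj G w₁ w₂ → Adj G w₂ v → ¬ Visible G X u v
  ¬visible₃ {u = u} {v} u≢v ¬uv mid mid₂ h₁ h₂ h₃ vis
    with visible⇒avoiding-within vis (_ ∷⟨ h₁ ⟩ (_ ∷⟨ h₂ ⟩ (_ ∷⟨ h₃ ⟩ [ _ ])))
  ... | [ _ ] , _ = u≢v refl
  ... | (_ ∷⟨ uv ⟩ [ _ ]) , _ = ¬uv uv
  ... | (_ ∷⟨ uw′ ⟩ (_ ∷⟨ w′v ⟩ [ _ ])) , _ , _ ∷ w′-end ∷ _ =
    [ adj-irrefl uw′ ∘ sym , adj-irrefl w′v ]′ (w′-end (mid uw′ w′v))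
  ... | (_ ∷⟨ uw₁ ⟩ (_ ∷⟨ w₁w₂ ⟩ (_ ∷⟨ w₂v ⟩ [ _ ]))) , _ , _ ∷ w₁-end ∷ w₂-end ∷ _
    with mid₂ uw₁ w₁w₂ w₂v
  ...   | inj₁ w₁∈X = [ adj-irrefl uw₁ ∘ sym , (λ w₁≡v → ¬uv (subst (Adj G u) w₁≡v uw₁)) ]′ (w₁-end w₁∈X)
  ...   | inj₂ w₂∈X = [ (λ w₂≡u → ¬uv (subst (λ t → Adj G t v) w₂≡u w₂v)) , adj-irrefl w₂v ]′ (w₂-end w₂∈X)
  ¬visible₃ _ _ _ _ _ _ _ _ | (_ ∷⟨ _ ⟩ (_ ∷⟨ _ ⟩ (_ ∷⟨ _ ⟩ (_ ∷⟨ _ ⟩ _)))) , s≤s (s≤s (s≤s ())) , _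

  SameSide : Subset n → Fin n → Fin n → Set
  SameSide Y u v = (u ∈ Y × v ∈ Y) ⊎ (u ∉ Y × v ∉ Y)

  module DualMV (dual : IsDualMV G Y) where

    ∈⇒∉ : ¬ Visible G Y u v → u ∈ Y → v ∉ Y
    ∈⇒∉ ¬vis u∈Y v∈Y = ¬vis (dual _ _ (inj₁ (u∈Y , v∈Y)))

    ∉⇒∈ : ¬ Visible G Y u v → u ∉ Y → v ∈ Y
    ∉⇒∈ {v = v} ¬vis u∉Y with v ∈? Y
    ... | yes v∈Y = v∈Y
    ... | no v∉Y = ⊥-elim (¬vis (dual _ _ (inj₂ (u∉Y , v∉Y))))

    pigeonhole : ∀ {u₀ u₁ u₂} → ¬ Visible G Y u₀ u₁ → ¬ Visible G Y u₀ u₂ → ¬ Visible G Y u₁ u₂ → ⊥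
    pigeonhole {u₀} ¬01 ¬02 ¬12 with u₀ ∈? Y
    ... | yes u₀∈Y = ¬12 (dual _ _ (inj₂ (∈⇒∉ ¬01 u₀∈Y , ∈⇒∉ ¬02 u₀∈Y)))
    ... | no u₀∉Y = ¬12 (dual _ _ (inj₁ (∉⇒∈ ¬01 u₀∉Y , ∉⇒∈ ¬02 u₀∉Y)))


module Subsets where

  open import Data.Nat using (_+_; _≤_; z≤n; s≤s)
  open import Data.Nat.Properties using (≤-trans; ≤-reflexive; n≤1+n; +-suc; +-monoʳ-≤; module ≤-Reasoning)

  private variable
    n : ℕ

  ∈-tabulate : {f : Fin n → Bool} {u : Fin n} → u ∈ tabulate f ⇔ f u ≡ true
  ∈-tabulate {f = f} {u} = mk⇔
    (λ u∈ → trans (sym (lookup∘tabulate f u)) ([]=⇒lookup u∈))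
    (λ fu → lookup⇒[]= u (tabulate f) (trans (lookup∘tabulate f u) fu))

  ∣tabulate-false∣ : (f : Fin n → Bool) → (∀ i → f i ≡ false) → ∣ tabulate f ∣ ≡ 0
  ∣tabulate-false∣ {zero} f _ = refl
  ∣tabulate-false∣ {suc n} f f≡false rewrite f≡false zero = ∣tabulate-false∣ (f ∘ suc) (f≡false ∘ suc)

  ∣p∪q∣≤∣p∣+∣q∣ : (p q : Subset n) → ∣ p ∪ q ∣ ≤ ∣ p ∣ + ∣ q ∣
  ∣p∪q∣≤∣p∣+∣q∣ [] [] = z≤n
  ∣p∪q∣≤∣p∣+∣q∣ (inside ∷ p) (inside ∷ q) = s≤s (≤-trans (∣p∪q∣≤∣p∣+∣q∣ p q) (+-monoʳ-≤ ∣ p ∣ (n≤1+n ∣ q ∣)))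
  ∣p∪q∣≤∣p∣+∣q∣ (inside ∷ p) (outside ∷ q) = s≤s (∣p∪q∣≤∣p∣+∣q∣ p q)
  ∣p∪q∣≤∣p∣+∣q∣ (outside ∷ p) (inside ∷ q) rewrite +-suc ∣ p ∣ ∣ q ∣ = s≤s (∣p∪q∣≤∣p∣+∣q∣ p q)
  ∣p∪q∣≤∣p∣+∣q∣ (outside ∷ p) (outside ∷ q) = ∣p∪q∣≤∣p∣+∣q∣ p q

  ∣∣≤1 : {Y : Subset n} {w : Fin n} → (∀ {u} → u ∈ Y → u ≡ w) → ∣ Y ∣ ≤ 1
  ∣∣≤1 {w = w} ∈⇒≡ = ≤-trans (p⊆q⇒∣p∣≤∣q∣ λ u∈ → subst (_∈ ⁅ w ⁆) (sym (∈⇒≡ u∈)) (x∈⁅x⁆ w))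
                             (≤-reflexive (∣⁅x⁆∣≡1 w))

  ∣∣≤2 : {Y : Subset n} {w₁ w₂ : Fin n} → (∀ {u} → u ∈ Y → u ≡ w₁ ⊎ u ≡ w₂) → ∣ Y ∣ ≤ 2
  ∣∣≤2 {w₁ = w₁} {w₂} ∈⇒≡ = begin
    _                          ≤⟨ p⊆q⇒∣p∣≤∣q∣ (x∈p∪q⁺ ∘ Sum.map (∈⁅⁆ w₁) (∈⁅⁆ w₂) ∘ ∈⇒≡) ⟩
    ∣ ⁅ w₁ ⁆ ∪ ⁅ w₂ ⁆ ∣        ≤⟨ ∣p∪q∣≤∣p∣+∣q∣ ⁅ w₁ ⁆ ⁅ w₂ ⁆ ⟩
    ∣ ⁅ w₁ ⁆ ∣ + ∣ ⁅ w₂ ⁆ ∣    ≡⟨ cong₂ _+_ (∣⁅x⁆∣≡1 w₁) (∣⁅x⁆∣≡1 w₂) ⟩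
    2                          ∎
    where
    open ≤-Reasoning
    ∈⁅⁆ : ∀ w {u} → u ≡ w → u ∈ ⁅ w ⁆
    ∈⁅⁆ w refl = x∈⁅x⁆ w

open Subsets

EndPair : {A : Set} → A → A → A → A → Set
EndPair u v x y = (x ≡ u × y ≡ v) ⊎ (x ≡ v × y ≡ u)

isEndPair⇔ : ∀ {n} {u v x y : Fin n} → isEndPair u v x y ≡ true ⇔ EndPair u v x y
isEndPair⇔ {u = u} {v} {x} {y} = ⇔-trans (⇔-sym T-≡) (⇔-trans T-∨ (⇔-trans (T-∧ ⊎-⇔ T-∧)
  ((T⌊ x ≟ u ⌋ ×-⇔ T⌊ y ≟ v ⌋) ⊎-⇔ (T⌊ x ≟ v ⌋ ×-⇔ T⌊ y ≟ u ⌋))))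
  where
  T⌊_⌋ : ∀ {A : Set} (a? : Dec A) → T ⌊ a? ⌋ ⇔ A
  T⌊ _ ⌋ = mk⇔ toWitness fromWitness

Adj-removeEdge : ∀ {n} {G : Graph n} {u v x y : Fin n} →
                 Adj (removeEdge G u v) x y ⇔ (Adj G x y × ¬ EndPair u v x y)
Adj-removeEdge {G = G} {u} {v} {x} {y} with isEndPair u v x y in e
... | true = mk⇔ (λ h → case trans (sym (∧-zeroʳ (adj G x y))) h of λ ())
                 (λ (_ , ¬ep) → ⊥-elim (¬ep (Equivalence.to isEndPair⇔ e)))
... | false = mk⇔ (λ h → trans (sym (∧-identityʳ _)) h ,
                         λ ep → case trans (sym e) (Equivalence.from isEndPair⇔ ep) of λ ())
                  (λ (h , _) → trans (∧-identityʳ _) h)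

does-true⇔ : {A : Set} (a? : Dec A) → does a? ≡ true ⇔ A
does-true⇔ (yes a) = mk⇔ (λ _ → a) (λ _ → refl)
does-true⇔ (no ¬a) = mk⇔ (λ ()) (⊥-elim ∘ ¬a)

data Tier : Set where
  ta tb td : Tier

blocks : ℕ → ℕ
blocks zero = zero
blocks (suc k) = 3 ℕ.+ blocks k

-- The successor clause comes first so that encB τ (suc i) computes for a variable tier τ.
encB : ∀ {k} → Tier → Fin k → Fin (blocks k)
encB τ (suc i) = suc (suc (suc (encB τ i)))
encB ta zero = zero
encB tb zero = suc zero
encB td zero = suc (suc zero)

decB : ∀ {k} → Fin (blocks k) → Tier × Fin k
decB {suc k} zero = ta , zero
decB {suc k} (suc zero) = tb , zero
decB {suc k} (suc (suc zero)) = td , zero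
decB {suc k} (suc (suc (suc i))) = proj₁ (decB {k} i) , suc (proj₂ (decB {k} i))

decB-encB : ∀ {k} τ (i : Fin k) → decB {k} (encB τ i) ≡ (τ , i)
decB-encB ta zero = refl
decB-encB tb zero = refl
decB-encB td zero = refl
decB-encB {suc k} τ (suc i) rewrite decB-encB {k} τ i = refl

encB-decB : ∀ {k} (i : Fin (blocks k)) → encB (proj₁ (decB {k} i)) (proj₂ (decB {k} i)) ≡ i
encB-decB {suc k} zero = refl
encB-decB {suc k} (suc zero) = refl
encB-decB {suc k} (suc (suc zero)) = refl
encB-decB {suc k} (suc (suc (suc i))) = cong (λ j → suc (suc (suc j))) (encB-decB {k} i)

isA : Tier → Bool
isA ta = true
isA _ = false

∣tabulate-isA∣ : ∀ k (f : Fin (blocks k) → Bool) → (∀ i → f i ≡ isA (proj₁ (decB {k} i))) → ∣ tabulate f ∣ ≡ k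
∣tabulate-isA∣ zero f _ = refl
∣tabulate-isA∣ (suc k) f f≡ rewrite f≡ zero | f≡ (suc zero) | f≡ (suc (suc zero)) =
  cong suc (∣tabulate-isA∣ k (λ i → f (suc (suc (suc i)))) (λ i → f≡ (suc (suc (suc i)))))

module Family (t : ℕ) where

  open import Data.Nat using (_+_; _≤_; z≤n; s≤s)
  open import Data.Nat.Properties using (≤-trans; ≤-reflexive; m≤n⇒m≤1+n)

  k : ℕ
  k = 3 + t

  N : ℕ
  N = 4 + blocks k

  data V : Set where
    vx vy vh vg : V
    blk : Tier → Fin k → V

  pattern va i = blk ta i
  pattern vb i = blk tb i
  pattern vd i = blk td i

  enc : V → Fin N
  enc vx = zero
  enc vy = suc zero
  enc vh = suc (suc zero)
  enc vg = suc (suc (suc zero))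
  enc (blk τ i) = suc (suc (suc (suc (encB τ i))))

  dec : Fin N → V
  dec zero = vx
  dec (suc zero) = vy
  dec (suc (suc zero)) = vh
  dec (suc (suc (suc zero))) = vg
  dec (suc (suc (suc (suc i)))) = blk (proj₁ (decB {k} i)) (proj₂ (decB {k} i))

  dec-enc : ∀ p → dec (enc p) ≡ p
  dec-enc vx = refl
  dec-enc vy = refl
  dec-enc vh = refl
  dec-enc vg = refl
  dec-enc (blk τ i) rewrite decB-encB {k} τ i = refl

  enc-dec : ∀ u → enc (dec u) ≡ u
  enc-dec zero = refl
  enc-dec (suc zero) = refl
  enc-dec (suc (suc zero)) = refl
  enc-dec (suc (suc (suc zero))) = refl
  enc-dec (suc (suc (suc (suc i)))) = cong (λ j → suc (suc (suc (suc j)))) (encB-decB {k} i)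

  enc≡⇔ : {p : V} {u : Fin N} → u ≡ enc p ⇔ dec u ≡ p
  enc≡⇔ {p} {u} = mk⇔ (λ { refl → dec-enc p }) (λ { refl → sym (enc-dec u) })

  data Edge : V → V → Set where
    xa : ∀ i → Edge vx (va i)
    ax : ∀ i → Edge (va i) vx
    ha : ∀ i → Edge vh (va i)
    ah : ∀ i → Edge (va i) vh
    ab : ∀ i → Edge (va i) (vb i)
    ba : ∀ i → Edge (vb i) (va i)
    gb : ∀ i → Edge vg (vb i)
    bg : ∀ i → Edge (vb i) vg
    bd : ∀ i → Edge (vb i) (vd i)
    db : ∀ i → Edge (vd i) (vb i)
    yd : ∀ i → Edge vy (vd i)
    dy : ∀ i → Edge (vd i) vy

  data _~⟨_,_⟩_ : V → Bool → Bool → V → Set where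
    edge : ∀ {p q e₁ e₂} → Edge p q → p ~⟨ e₁ , e₂ ⟩ q
    x~y : ∀ {e₂} → vx ~⟨ true , e₂ ⟩ vy
    y~x : ∀ {e₂} → vy ~⟨ true , e₂ ⟩ vx
    h~g : ∀ {e₁} → vh ~⟨ e₁ , true ⟩ vg
    g~h : ∀ {e₁} → vg ~⟨ e₁ , true ⟩ vh

  pattern x~a i = edge (xa i)
  pattern a~x i = edge (ax i)
  pattern h~a i = edge (ha i)
  pattern a~h i = edge (ah i)
  pattern a~b i = edge (ab i)
  pattern b~a i = edge (ba i)
  pattern g~b i = edge (gb i)
  pattern b~g i = edge (bg i)
  pattern b~d i = edge (bd i)
  pattern d~b i = edge (db i)
  pattern y~d i = edge (yd i)
  pattern d~y i = edge (dy i)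

  Edge-sym : ∀ {p q} → Edge p q → Edge q p
  Edge-sym (xa i) = ax i
  Edge-sym (ax i) = xa i
  Edge-sym (ha i) = ah i
  Edge-sym (ah i) = ha i
  Edge-sym (ab i) = ba i
  Edge-sym (ba i) = ab i
  Edge-sym (gb i) = bg i
  Edge-sym (bg i) = gb i
  Edge-sym (bd i) = db i
  Edge-sym (db i) = bd i
  Edge-sym (yd i) = dy i
  Edge-sym (dy i) = yd i

  ~-sym : ∀ {p q e₁ e₂} → p ~⟨ e₁ , e₂ ⟩ q → q ~⟨ e₁ , e₂ ⟩ p
  ~-sym (edge e) = edge (Edge-sym e)
  ~-sym x~y = y~x
  ~-sym y~x = x~y
  ~-sym h~g = g~h
  ~-sym g~h = h~g

  ~-irrefl : ∀ {p e₁ e₂} → ¬ p ~⟨ e₁ , e₂ ⟩ p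
  ~-irrefl (edge ())

  _~?_ : (p q : V) → Dec (p ~⟨ true , true ⟩ q)
  vx ~? vx = no λ { (edge ()) }
  vx ~? vy = yes x~y
  vx ~? vh = no λ { (edge ()) }
  vx ~? vg = no λ { (edge ()) }
  vx ~? va j = yes (x~a j)
  vx ~? vb j = no λ { (edge ()) }
  vx ~? vd j = no λ { (edge ()) }
  vy ~? vx = yes y~x
  vy ~? vy = no λ { (edge ()) }
  vy ~? vh = no λ { (edge ()) }
  vy ~? vg = no λ { (edge ()) }
  vy ~? va j = no λ { (edge ()) }
  vy ~? vb j = no λ { (edge ()) }
  vy ~? vd j = yes (y~d j)
  vh ~? vx = no λ { (edge ()) }
  vh ~? vy = no λ { (edge ()) }
  vh ~? vh = no λ { (edge ()) }
  vh ~? vg = yes h~g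
  vh ~? va j = yes (h~a j)
  vh ~? vb j = no λ { (edge ()) }
  vh ~? vd j = no λ { (edge ()) }
  vg ~? vx = no λ { (edge ()) }
  vg ~? vy = no λ { (edge ()) }
  vg ~? vh = yes g~h
  vg ~? vg = no λ { (edge ()) }
  vg ~? va j = no λ { (edge ()) }
  vg ~? vb j = yes (g~b j)
  vg ~? vd j = no λ { (edge ()) }
  va i ~? vx = yes (a~x i)
  va i ~? vy = no λ { (edge ()) }
  va i ~? vh = yes (a~h i)
  va i ~? vg = no λ { (edge ()) }
  va i ~? va j = no λ { (edge ()) }
  va i ~? vb j with i ≟ j
  ... | yes refl = yes (a~b i)
  ... | no i≢j = no λ { (a~b _) → i≢j refl }
  va i ~? vd j = no λ { (edge ()) }
  vb i ~? vx = no λ { (edge ()) }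
  vb i ~? vy = no λ { (edge ()) }
  vb i ~? vh = no λ { (edge ()) }
  vb i ~? vg = yes (b~g i)
  vb i ~? va j with i ≟ j
  ... | yes refl = yes (b~a i)
  ... | no i≢j = no λ { (b~a _) → i≢j refl }
  vb i ~? vb j = no λ { (edge ()) }
  vb i ~? vd j with i ≟ j
  ... | yes refl = yes (b~d i)
  ... | no i≢j = no λ { (b~d _) → i≢j refl }
  vd i ~? vx = no λ { (edge ()) }
  vd i ~? vy = yes (d~y i)
  vd i ~? vh = no λ { (edge ()) }
  vd i ~? vg = no λ { (edge ()) }
  vd i ~? va j = no λ { (edge ()) }
  vd i ~? vb j with i ≟ j
  ... | yes refl = yes (d~b i)
  ... | no i≢j = no λ { (d~b _) → i≢j refl }
  vd i ~? vd j = no λ { (edge ()) }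

  G₁₁ : Graph N
  adj G₁₁ u v = does (dec u ~? dec v)
  Graph.sym G₁₁ u v = does-⇔ (mk⇔ ~-sym ~-sym) (dec u ~? dec v) (dec v ~? dec u)
  irrefl G₁₁ u = dec-false (dec u ~? dec u) ~-irrefl

  G₀₁ : Graph N
  G₀₁ = removeEdge G₁₁ (enc vx) (enc vy)

  G₀₀ : Graph N
  G₀₀ = removeEdge G₀₁ (enc vh) (enc vg)

  Represents : Graph N → (V → V → Set) → Set
  Represents G R = ∀ u v → Adj G u v ⇔ R (dec u) (dec v)

  represents-removeEdge : ∀ {G R R′ r s} → Represents G R → (∀ {p q} → R′ p q ⇔ (R p q × ¬ EndPair r s p q)) →
                          Represents (removeEdge G (enc r) (enc s)) R′
  represents-removeEdge {G} rep R′⇔ u v = ⇔-trans (Adj-removeEdge {G = G})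
    (⇔-trans (rep u v ×-⇔ ¬-cong-⇔ ((enc≡⇔ ×-⇔ enc≡⇔) ⊎-⇔ (enc≡⇔ ×-⇔ enc≡⇔))) (⇔-sym R′⇔))

  ~-without-xy : ∀ {p q e₂} → p ~⟨ false , e₂ ⟩ q ⇔ (p ~⟨ true , e₂ ⟩ q × ¬ EndPair vx vy p q)
  ~-without-xy = mk⇔
    (λ { (edge e) → edge e , λ { (inj₁ (refl , refl)) → case e of λ () ; (inj₂ (refl , refl)) → case e of λ () }
       ; h~g → h~g , λ { (inj₁ (() , _)) ; (inj₂ (() , _)) }
       ; g~h → g~h , λ { (inj₁ (() , _)) ; (inj₂ (() , _)) } })
    (λ { (edge e , _) → edge e ; (x~y , ¬xy) → ⊥-elim (¬xy (inj₁ (refl , refl)))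
       ; (y~x , ¬xy) → ⊥-elim (¬xy (inj₂ (refl , refl))) ; (h~g , _) → h~g ; (g~h , _) → g~h })

  ~-without-hg : ∀ {p q e₁} → p ~⟨ e₁ , false ⟩ q ⇔ (p ~⟨ e₁ , true ⟩ q × ¬ EndPair vh vg p q)
  ~-without-hg = mk⇔
    (λ { (edge e) → edge e , λ { (inj₁ (refl , refl)) → case e of λ () ; (inj₂ (refl , refl)) → case e of λ () }
       ; x~y → x~y , λ { (inj₁ (() , _)) ; (inj₂ (() , _)) }
       ; y~x → y~x , λ { (inj₁ (() , _)) ; (inj₂ (() , _)) } })
    (λ { (edge e , _) → edge e ; (h~g , ¬hg) → ⊥-elim (¬hg (inj₁ (refl , refl)))
       ; (g~h , ¬hg) → ⊥-elim (¬hg (inj₂ (refl , refl))) ; (x~y , _) → x~y ; (y~x , _) → y~x })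

  G₁₁-represents : Represents G₁₁ _~⟨ true , true ⟩_
  G₁₁-represents u v = does-true⇔ (dec u ~? dec v)

  G₀₁-represents : Represents G₀₁ _~⟨ false , true ⟩_
  G₀₁-represents = represents-removeEdge {G₁₁} G₁₁-represents ~-without-xy

  G₀₀-represents : Represents G₀₀ _~⟨ false , false ⟩_
  G₀₀-represents = represents-removeEdge {G₀₁} G₀₁-represents ~-without-hg

  ⟦_⟧ : (V → Bool) → Subset N
  ⟦ P ⟧ = tabulate (P ∘ dec)

  enc-injective : ∀ {p q} → enc p ≡ enc q → p ≡ q
  enc-injective {p} {q} e = trans (sym (dec-enc p)) (trans (cong dec e) (dec-enc q))

  blk-injective : ∀ {τ i j} → blk τ i ≡ blk τ j → i ≡ j
  blk-injective refl = refl

  module FamilyGraph {e₁ e₂ : Bool} (G : Graph N) (rep : Represents G _~⟨ e₁ , e₂ ⟩_) where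

    open Walks G public

    _~_ : V → V → Set
    p ~ q = p ~⟨ e₁ , e₂ ⟩ q

    Vis : Subset N → V → V → Set
    Vis X p q = Visible G X (enc p) (enc q)

    adjacent : ∀ {p q} → p ~ q → Adj G (enc p) (enc q)
    adjacent {p} {q} p~q = Equivalence.from (rep (enc p) (enc q))
      (subst₂ _~_ (sym (dec-enc p)) (sym (dec-enc q)) p~q)

    dec-adjacent : ∀ {u v} → Adj G u v → dec u ~ dec v
    dec-adjacent {u} {v} = Equivalence.to (rep u v)

    adjacent-from : ∀ {p w} → Adj G (enc p) w → p ~ dec w
    adjacent-from {p} uw = subst (_~ _) (dec-enc p) (dec-adjacent uw)

    adjacent-to : ∀ {q w} → Adj G w (enc q) → dec w ~ q
    adjacent-to {q} wv = subst (_ ~_) (dec-enc q) (dec-adjacent wv)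

    adjacent⁻ : ∀ {p q} → Adj G (enc p) (enc q) → p ~ q
    adjacent⁻ {q = q} pq = subst (_ ~_) (dec-enc q) (adjacent-from pq)

    ∈-dec : ∀ {Y : Subset N} {w} → enc (dec w) ∈ Y → w ∈ Y
    ∈-dec {Y} = subst (_∈ Y) (enc-dec _)

    _∷~_ : ∀ {p q v} → p ~ q → Walk G (enc q) v → Walk G (enc p) v
    p~q ∷~ w = _ ∷⟨ adjacent p~q ⟩ w

    connected : Connected G
    connected = connected-via (enc vx) λ u → subst (λ w → Walk G w (enc vx)) (enc-dec u) (to-x (dec u))
      where
      a→x : ∀ i → Walk G (enc (va i)) (enc vx)
      a→x i = a~x i ∷~ [ _ ]
      b→x : ∀ i → Walk G (enc (vb i)) (enc vx)
      b→x i = b~a i ∷~ a→x i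
      d→x : ∀ i → Walk G (enc (vd i)) (enc vx)
      d→x i = d~b i ∷~ b→x i
      to-x : ∀ p → Walk G (enc p) (enc vx)
      to-x vx = [ _ ]
      to-x vy = y~d zero ∷~ d→x zero
      to-x vh = h~a zero ∷~ a→x zero
      to-x vg = g~b zero ∷~ b→x zero
      to-x (va i) = a→x i
      to-x (vb i) = b→x i
      to-x (vd i) = d→x i

    module Witness (P : V → Bool) where

      ∈⟦P⟧ : ∀ {w} → w ∈ ⟦ P ⟧ ⇔ P (dec w) ≡ true
      ∈⟦P⟧ = ∈-tabulate {f = P ∘ dec}

      ∉⟦P⟧ : ∀ {w} → P (dec w) ≡ false → w ∉ ⟦ P ⟧
      ∉⟦P⟧ Pw≡false w∈ = case trans (sym Pw≡false) (Equivalence.to ∈⟦P⟧ w∈) of λ ()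

      enc∉⟦P⟧ : ∀ {r} → P r ≡ false → enc r ∉ ⟦ P ⟧
      enc∉⟦P⟧ {r} Pr≡false = ∉⟦P⟧ (trans (cong P (dec-enc r)) Pr≡false)

      via₁ : ∀ {p q} → p ~ q → Vis ⟦ P ⟧ p q
      via₁ pq = visible-via₁ (adjacent pq)

      via₂ : ∀ {p q r} → p ~ r → r ~ q → P r ≡ false → Vis ⟦ P ⟧ p q
      via₂ pr rq Pr = visible-via₂ (adjacent pr) (adjacent rq) (enc∉⟦P⟧ Pr)

      via₃ : ∀ {p q r s} → (∀ {w} → p ~ w → w ~ q → P w ≡ false) →
             p ~ r → r ~ s → s ~ q → P r ≡ false → P s ≡ false → Vis ⟦ P ⟧ p q
      via₃ mid pr rs sq Pr Ps = visible-via₃ (λ uw wv → ∉⟦P⟧ (mid (adjacent-from uw) (adjacent-to wv)))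
        (adjacent pr) (adjacent rs) (adjacent sq) (enc∉⟦P⟧ Pr) (enc∉⟦P⟧ Ps)

      via₄ : ∀ {p q r s z} → (∀ {w} → p ~ w → w ~ q → P w ≡ false) →
             (∀ {w₁ w₂} → p ~ w₁ → w₁ ~ w₂ → w₂ ~ q → P w₁ ≡ false × P w₂ ≡ false) →
             p ~ r → r ~ s → s ~ z → z ~ q → P r ≡ false → P s ≡ false → P z ≡ false → Vis ⟦ P ⟧ p q
      via₄ mid mid₂ pr rs sz zq Pr Ps Pz = visible-via₄
        (λ uw wv → ∉⟦P⟧ (mid (adjacent-from uw) (adjacent-to wv)))
        (λ uw₁ w₁w₂ w₂v → Product.map ∉⟦P⟧ ∉⟦P⟧ (mid₂ (adjacent-from uw₁) (dec-adjacent w₁w₂) (adjacent-to w₂v)))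
        (adjacent pr) (adjacent rs) (adjacent sz) (adjacent zq) (enc∉⟦P⟧ Pr) (enc∉⟦P⟧ Ps) (enc∉⟦P⟧ Pz)

      dualMV : (∀ p q → P p ≡ P q → Vis ⟦ P ⟧ p q) → IsDualMV G ⟦ P ⟧
      dualMV vis u v same = subst₂ (Visible G ⟦ P ⟧) (enc-dec u) (enc-dec v) (vis (dec u) (dec v) (P≡ same))
        where
        P≡ : SameSide ⟦ P ⟧ u v → P (dec u) ≡ P (dec v)
        P≡ (inj₁ (u∈ , v∈)) = trans (Equivalence.to ∈⟦P⟧ u∈) (sym (Equivalence.to ∈⟦P⟧ v∈))
        P≡ (inj₂ (u∉ , v∉)) = trans (¬-not (u∉ ∘ Equivalence.from ∈⟦P⟧))
                                    (sym (¬-not (v∉ ∘ Equivalence.from ∈⟦P⟧)))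

    ¬vis₂ : ∀ {Y p q r} → p ≢ q → ¬ p ~ q → (∀ {w} → p ~ w → w ~ q → enc w ∈ Y) →
            p ~ r → r ~ q → ¬ Vis Y p q
    ¬vis₂ p≢q ¬pq mid pr rq = ¬visible₂ (p≢q ∘ enc-injective) (¬pq ∘ adjacent⁻)
      (λ uw wv → ∈-dec (mid (adjacent-from uw) (adjacent-to wv))) (adjacent pr) (adjacent rq)

    ¬vis₃ : ∀ {Y p q r s} → p ≢ q → ¬ p ~ q → (∀ {w} → p ~ w → w ~ q → enc w ∈ Y) →
            (∀ {w₁ w₂} → p ~ w₁ → w₁ ~ w₂ → w₂ ~ q → enc w₁ ∈ Y ⊎ enc w₂ ∈ Y) →
            p ~ r → r ~ s → s ~ q → ¬ Vis Y p q
    ¬vis₃ p≢q ¬pq mid mid₂ pr rs sq = ¬visible₃ (p≢q ∘ enc-injective) (¬pq ∘ adjacent⁻)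
      (λ uw wv → ∈-dec (mid (adjacent-from uw) (adjacent-to wv)))
      (λ uw₁ w₁w₂ w₂v → Sum.map ∈-dec ∈-dec (mid₂ (adjacent-from uw₁) (dec-adjacent w₁w₂) (adjacent-to w₂v)))
      (adjacent pr) (adjacent rs) (adjacent sq)

    module Bounds {Y : Subset N} (dual : IsDualMV G Y) where

      open DualMV dual public

      members : ∀ {Q : V → Set} → (∀ {p} → enc p ∈ Y → Q p) → ∀ {u} → u ∈ Y → Q (dec u)
      members f u∈Y = f (subst (_∈ Y) (sym (enc-dec _)) u∈Y)

      from-dec : ∀ {u p} → dec u ≡ p → u ≡ enc p
      from-dec = Equivalence.from enc≡⇔

      no-three-blocked : ∀ {τ} → (∀ {i j} → i ≢ j → ¬ Vis Y (blk τ i) (blk τ j)) → ⊥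
      no-three-blocked ¬vis = pigeonhole (¬vis {zero} {suc zero} λ ())
        (¬vis {zero} {suc (suc zero)} λ ()) (¬vis {suc zero} {suc (suc zero)} λ ())

      y∉Y : enc vy ∉ Y
      y∉Y y∈Y = no-three-blocked {td} λ i≢j → ¬vis₂ (i≢j ∘ blk-injective) (λ { (edge ()) })
        (λ { (d~y _) (y~d _) → y∈Y ; (d~b _) (b~d _) → ⊥-elim (i≢j refl) }) (d~y _) (y~d _)

      g∉Y : enc vg ∉ Y
      g∉Y g∈Y = no-three-blocked {tb} λ i≢j → ¬vis₂ (i≢j ∘ blk-injective) (λ { (edge ()) })
        (λ { (b~g _) (g~b _) → g∈Y ; (b~a _) (a~b _) → ⊥-elim (i≢j refl) ; (b~d _) (d~b _) → ⊥-elim (i≢j refl) })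
        (b~g _) (g~b _)

      x∈Y⇒h∉Y : enc vx ∈ Y → enc vh ∉ Y
      x∈Y⇒h∉Y x∈Y h∈Y = no-three-blocked {ta} λ i≢j → ¬vis₂ (i≢j ∘ blk-injective) (λ { (edge ()) })
        (λ { (a~x _) (x~a _) → x∈Y ; (a~h _) (h~a _) → h∈Y ; (a~b _) (b~a _) → ⊥-elim (i≢j refl) })
        (a~x _) (x~a _)

      b∈Y⇒d∈Y : ∀ {i} → enc (vb i) ∈ Y → enc (vd i) ∈ Y
      b∈Y⇒d∈Y {i} b∈Y = ∉⇒∈ (¬vis₂ (λ ()) (λ { (edge ()) }) (λ { (g~b _) (b~d _) → b∈Y ; g~h (edge ()) })
        (g~b i) (b~d i)) g∉Y

      d∈Y⇒b∈Y : ∀ {i} → enc (vd i) ∈ Y → enc (vb i) ∈ Y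
      d∈Y⇒b∈Y {i} d∈Y = ∉⇒∈ (¬vis₂ (λ ()) (λ { (edge ()) }) (λ { (y~d _) (d~b _) → d∈Y ; y~x (edge ()) })
        (y~d i) (d~b i)) y∉Y

      a∈Y⇒x∈Y : ∀ {i} → enc (va i) ∈ Y → enc (vb i) ∉ Y → enc vx ∈ Y
      a∈Y⇒x∈Y {i} a∈Y b∉Y = ∉⇒∈ (¬vis₂ (λ ()) (λ { (edge ()) })
        (λ { (b~a _) (a~x _) → a∈Y ; (b~g _) (edge ()) ; (b~d _) (edge ()) }) (b~a i) (a~x i)) b∉Y

      a∈Y⇒h∈Y : ¬ vh ~ vg → ∀ {i} → enc (va i) ∈ Y → enc (vb i) ∉ Y → enc vh ∈ Y
      a∈Y⇒h∈Y ¬hg {i} a∈Y b∉Y = ∉⇒∈ (¬vis₂ (λ ()) (λ { (edge ()) })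
        (λ { (b~a _) (a~h _) → a∈Y ; (b~g _) g~h → ⊥-elim (¬hg h~g) ; (b~d _) (edge ()) }) (b~a i) (a~h i)) b∉Y

      d∉Y : ¬ vx ~ vy → ∀ {i} → enc (vd i) ∉ Y
      d∉Y ¬xy {i} d∈Y = y∉Y (∉⇒∈ ¬vis-ay a∉Y)
        where
        b∈Y : enc (vb i) ∈ Y
        b∈Y = d∈Y⇒b∈Y d∈Y
        a∉Y : enc (va i) ∉ Y
        a∉Y = ∈⇒∉ (¬vis₂ (λ ()) (λ { (edge ()) }) (λ { (d~b _) (b~a _) → b∈Y ; (d~y _) (edge ()) })
          (d~b i) (b~a i)) d∈Y
        ¬vis-ay : ¬ Vis Y (va i) vy
        ¬vis-ay = ¬vis₃ (λ ()) (λ { (edge ()) })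
          (λ { (a~x _) x~y → ⊥-elim (¬xy x~y) ; (a~h _) (edge ()) ; (a~b _) (edge ()) })
          (λ { (a~x _) x~y (edge ()) ; (a~x _) (x~a _) (edge ()) ; (a~h _) (h~a _) (edge ()) ; (a~h _) h~g (edge ())
             ; (a~b _) (b~d _) (d~y _) → inj₁ b∈Y ; (a~b _) (b~a _) (edge ()) ; (a~b _) (b~g _) (edge ()) })
          (a~b i) (b~d i) (d~y i)

  module G₁₁-Properties where

    open FamilyGraph G₁₁ G₁₁-represents public

    P₁₁ : V → Bool
    P₁₁ (vb zero) = true
    P₁₁ (vd zero) = true
    P₁₁ _ = false

    open Witness P₁₁

    ∣⟦P₁₁⟧∣ : ∣ ⟦ P₁₁ ⟧ ∣ ≡ 2
    ∣⟦P₁₁⟧∣ = cong (λ m → suc (suc m)) (∣tabulate-false∣ (λ i → P₁₁ (dec (suc (suc (suc (suc (suc (suc (suc i)))))))))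
      λ i → P₁₁-suc (proj₁ (decB {2 + t} i)))
      where
      P₁₁-suc : ∀ τ {j} → P₁₁ (blk τ (suc j)) ≡ false
      P₁₁-suc ta = refl
      P₁₁-suc tb = refl
      P₁₁-suc td = refl

    -- A route need not be a shortest path, since only strictly shorter walks have to avoid the set; so
    -- one route serves for all indices, e.g. a_i x a_j also when i = j.
    vis : ∀ p q → P₁₁ p ≡ P₁₁ q → Vis ⟦ P₁₁ ⟧ p q
    vis vx vx _ = visible-refl
    vis vx vy _ = via₁ x~y
    vis vx vh _ = via₂ (x~a zero) (a~h zero) refl
    vis vx vg _ = via₃ (λ { (x~a _) (edge ()) ; x~y (edge ()) }) (x~a zero) (a~h zero) h~g refl refl
    vis vx (va j) _ = via₁ (x~a j)
    vis vx (vb j) _ = via₂ (x~a j) (a~b j) refl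
    vis vx (vd j) _ = via₂ x~y (y~d j) refl
    vis vy vx _ = via₁ y~x
    vis vy vy _ = visible-refl
    vis vy vh _ = via₃ (λ { y~x (edge ()) ; (y~d _) (edge ()) }) y~x (x~a zero) (a~h zero) refl refl
    vis vy vg _ = via₃ (λ { y~x (edge ()) ; (y~d _) (edge ()) })
        (y~d (suc zero)) (d~b (suc zero)) (b~g (suc zero)) refl refl
    vis vy (va j) _ = via₂ y~x (x~a j) refl
    vis vy (vb zero) ()
    vis vy (vb (suc j)) _ = via₂ (y~d (suc j)) (d~b (suc j)) refl
    vis vy (vd j) _ = via₁ (y~d j)
    vis vh vx _ = via₂ (h~a zero) (a~x zero) refl
    vis vh vy _ = via₃ (λ { (h~a _) (edge ()) ; h~g (edge ()) }) (h~a zero) (a~x zero) x~y refl refl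
    vis vh vh _ = visible-refl
    vis vh vg _ = via₁ h~g
    vis vh (va j) _ = via₁ (h~a j)
    vis vh (vb j) _ = via₂ h~g (g~b j) refl
    vis vh (vd zero) ()
    vis vh (vd (suc j)) _ = via₃ (λ { (h~a _) (edge ()) ; h~g (edge ()) }) h~g (g~b (suc j)) (b~d (suc j)) refl refl
    vis vg vx _ = via₃ (λ { (g~b _) (edge ()) ; g~h (edge ()) }) g~h (h~a zero) (a~x zero) refl refl
    vis vg vy _ = via₃ (λ { (g~b _) (edge ()) ; g~h (edge ()) })
        (g~b (suc zero)) (b~d (suc zero)) (d~y (suc zero)) refl refl
    vis vg vh _ = via₁ g~h
    vis vg vg _ = visible-refl
    vis vg (va j) _ = via₂ g~h (h~a j) refl
    vis vg (vb j) _ = via₁ (g~b j)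
    vis vg (vd zero) ()
    vis vg (vd (suc j)) _ = via₂ (g~b (suc j)) (b~d (suc j)) refl
    vis (va i) vx _ = via₁ (a~x i)
    vis (va i) vy _ = via₂ (a~x i) x~y refl
    vis (va i) vh _ = via₁ (a~h i)
    vis (va i) vg _ = via₂ (a~h i) h~g refl
    vis (va i) (va j) _ = via₂ (a~x i) (x~a j) refl
    vis (va i) (vb j) _ = via₃ (λ { (a~x _) (edge ()) ; (a~h _) (edge ()) ; (a~b _) (edge ()) })
        (a~x i) (x~a j) (a~b j) refl refl
    vis (va i) (vd zero) ()
    vis (va i) (vd (suc j)) _ = via₃ (λ { (a~x _) (edge ()) ; (a~h _) (edge ()) ; (a~b _) (b~d _) → refl })
        (a~x i) x~y (y~d (suc j)) refl refl
    vis (vb i) vx _ = via₂ (b~a i) (a~x i) refl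
    vis (vb zero) vy ()
    vis (vb (suc i)) vy _ = via₂ (b~d (suc i)) (d~y (suc i)) refl
    vis (vb i) vh _ = via₂ (b~g i) g~h refl
    vis (vb i) vg _ = via₁ (b~g i)
    vis (vb i) (va j) _ = via₃ (λ { (b~a _) (edge ()) ; (b~g _) (edge ()) ; (b~d _) (edge ()) })
        (b~a i) (a~x i) (x~a j) refl refl
    vis (vb i) (vb j) _ = via₂ (b~g i) (g~b j) refl
    vis (vb zero) (vd zero) _ = via₁ (b~d zero)
    vis (vb zero) (vd (suc j)) ()
    vis (vb (suc i)) (vd zero) ()
    vis (vb (suc i)) (vd (suc j)) _ = via₃ (λ { (b~a _) (edge ()) ; (b~g _) (edge ()) ; (b~d _) (edge ()) })
        (b~g (suc i)) (g~b (suc j)) (b~d (suc j)) refl refl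
    vis (vd i) vx _ = via₂ (d~y i) y~x refl
    vis (vd i) vy _ = via₁ (d~y i)
    vis (vd zero) vh ()
    vis (vd (suc i)) vh _ = via₃ (λ { (d~b _) (edge ()) ; (d~y _) (edge ()) })
        (d~b (suc i)) (b~g (suc i)) g~h refl refl
    vis (vd zero) vg ()
    vis (vd (suc i)) vg _ = via₂ (d~b (suc i)) (b~g (suc i)) refl
    vis (vd zero) (va j) ()
    vis (vd (suc i)) (va j) _ = via₃ (λ { (d~b _) (b~a _) → refl ; (d~y _) (edge ()) })
        (d~y (suc i)) y~x (x~a j) refl refl
    vis (vd zero) (vb zero) _ = via₁ (d~b zero)
    vis (vd zero) (vb (suc j)) ()
    vis (vd (suc i)) (vb zero) ()
    vis (vd (suc i)) (vb (suc j)) _ = via₃ (λ { (d~b _) (edge ()) ; (d~y _) (edge ()) })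
        (d~b (suc i)) (b~g (suc i)) (g~b (suc j)) refl refl
    vis (vd i) (vd j) _ = via₂ (d~y i) (y~d j) refl

    module _ {Y : Subset N} (dual : IsDualMV G₁₁ Y) where

      open Bounds dual

      x∉Y : enc vx ∉ Y
      x∉Y x∈Y = ¬vis-yh (dual _ _ (inj₂ (y∉Y , x∈Y⇒h∉Y x∈Y)))
        where
        ¬vis-yh : ¬ Vis Y vy vh
        ¬vis-yh = ¬vis₃ (λ ()) (λ { (edge ()) }) (λ { y~x (edge ()) ; (y~d _) (edge ()) })
          (λ { y~x (x~a _) (a~h _) → inj₁ x∈Y ; y~x x~y (edge ()) ; (y~d _) (d~b _) (edge ()) ; (y~d _) (d~y _) (edge ()) })
          y~x (x~a zero) (a~h zero)

      a∉Y : ∀ {i} → enc (va i) ∉ Y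
      a∉Y {i} a∈Y = ∈⇒∉ ¬vis-ad a∈Y (b∈Y⇒d∈Y b∈Y)
        where
        b∈Y : enc (vb i) ∈ Y
        b∈Y = ∉⇒∈ (¬vis₂ (λ ()) (λ { (edge ()) }) (λ { (x~a _) (a~b _) → a∈Y ; x~y (edge ()) }) (x~a i) (a~b i)) x∉Y
        ¬vis-ad : ¬ Vis Y (va i) (vd i)
        ¬vis-ad = ¬vis₂ (λ ()) (λ { (edge ()) }) (λ { (a~b _) (b~d _) → b∈Y ; (a~x _) (edge ()) ; (a~h _) (edge ()) })
          (a~b i) (b~d i)

      b∈Y⇒b∉Y : ∀ {i j} → i ≢ j → enc (vb i) ∈ Y → enc (vb j) ∉ Y
      b∈Y⇒b∉Y {i} {j} i≢j bi∈Y bj∈Y = ∈⇒∉ ¬vis-bd bi∈Y (b∈Y⇒d∈Y bj∈Y)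
        where
        ¬vis-bd : ¬ Vis Y (vb i) (vd j)
        ¬vis-bd = ¬vis₃ (λ ()) (λ { (b~d _) → i≢j refl })
          (λ { (b~a _) (edge ()) ; (b~g _) (edge ()) ; (b~d _) (edge ()) })
          (λ { (b~g _) (g~b _) (b~d _) → inj₂ bj∈Y ; (b~g _) g~h (edge ())
             ; (b~a _) (a~b _) (b~d _) → ⊥-elim (i≢j refl) ; (b~a _) (a~x _) (edge ()) ; (b~a _) (a~h _) (edge ())
             ; (b~d _) (d~y _) (y~d _) → inj₁ (b∈Y⇒d∈Y bi∈Y) ; (b~d _) (d~b _) (b~d _) → ⊥-elim (i≢j refl) })
          (b~g i) (g~b j) (b~d j)

      h∈Y⇒b∉Y : ∀ {i} → enc vh ∈ Y → enc (vb i) ∉ Y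
      h∈Y⇒b∉Y {i} h∈Y b∈Y = ∈⇒∉ ¬vis-hd h∈Y (b∈Y⇒d∈Y b∈Y)
        where
        ¬vis-hd : ¬ Vis Y vh (vd i)
        ¬vis-hd = ¬vis₃ (λ ()) (λ { (edge ()) }) (λ { (h~a _) (edge ()) ; h~g (edge ()) })
          (λ { h~g (g~b _) (b~d _) → inj₂ b∈Y ; h~g g~h (edge ())
             ; (h~a _) (a~b _) (b~d _) → inj₂ b∈Y ; (h~a _) (a~x _) (edge ()) ; (h~a _) (a~h _) (edge ()) })
          h~g (g~b i) (b~d i)

      within-block : ∀ {i} → enc (vb i) ∈ Y → ∀ {p} → enc p ∈ Y → p ≡ vb i ⊎ p ≡ vd i
      within-block b∈Y {vx} = ⊥-elim ∘ x∉Y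
      within-block b∈Y {vy} = ⊥-elim ∘ y∉Y
      within-block b∈Y {vh} h∈Y = ⊥-elim (h∈Y⇒b∉Y h∈Y b∈Y)
      within-block b∈Y {vg} = ⊥-elim ∘ g∉Y
      within-block b∈Y {va _} = ⊥-elim ∘ a∉Y
      within-block {i} b∈Y {vb j} bj∈Y with j ≟ i
      ... | yes refl = inj₁ refl
      ... | no j≢i = ⊥-elim (b∈Y⇒b∉Y j≢i bj∈Y b∈Y)
      within-block {i} b∈Y {vd j} dj∈Y with j ≟ i
      ... | yes refl = inj₂ refl
      ... | no j≢i = ⊥-elim (b∈Y⇒b∉Y j≢i (d∈Y⇒b∈Y dj∈Y) b∈Y)

      only-h : (∀ i → enc (vb i) ∉ Y) → ∀ {p} → enc p ∈ Y → p ≡ vh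
      only-h b∉Y {vx} = ⊥-elim ∘ x∉Y
      only-h b∉Y {vy} = ⊥-elim ∘ y∉Y
      only-h b∉Y {vh} _ = refl
      only-h b∉Y {vg} = ⊥-elim ∘ g∉Y
      only-h b∉Y {va _} = ⊥-elim ∘ a∉Y
      only-h b∉Y {vb i} = ⊥-elim ∘ b∉Y i
      only-h b∉Y {vd i} = ⊥-elim ∘ b∉Y i ∘ d∈Y⇒b∈Y

      ∣Y∣≤2 : ∣ Y ∣ ≤ 2
      ∣Y∣≤2 with any? (λ i → enc (vb i) ∈? Y)
      ... | yes (i , b∈Y) = ∣∣≤2 (Data.Sum.map from-dec from-dec ∘ members (within-block b∈Y))
      ... | no ∄i = m≤n⇒m≤1+n (∣∣≤1 (from-dec ∘ members (only-h λ i b∈Y → ∄i (i , b∈Y))))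

    μ-G₁₁ : IsMuD G₁₁ 2
    μ-G₁₁ = (⟦ P₁₁ ⟧ , dualMV vis , ∣⟦P₁₁⟧∣) , λ Y dual → ∣Y∣≤2 dual

  module G₀₁-Properties where

    open FamilyGraph G₀₁ G₀₁-represents public

    P₀₁ : V → Bool
    P₀₁ vx = true
    P₀₁ (va _) = true
    P₀₁ _ = false

    open Witness P₀₁

    ∣⟦P₀₁⟧∣ : ∣ ⟦ P₀₁ ⟧ ∣ ≡ suc k
    ∣⟦P₀₁⟧∣ = cong suc (∣tabulate-isA∣ k (λ i → P₀₁ (dec (suc (suc (suc (suc i))))))
      λ i → P₀₁-blk (proj₁ (decB {k} i)))
      where
      P₀₁-blk : ∀ τ {j} → P₀₁ (blk τ j) ≡ isA τ
      P₀₁-blk ta = refl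
      P₀₁-blk tb = refl
      P₀₁-blk td = refl

    vis : ∀ p q → P₀₁ p ≡ P₀₁ q → Vis ⟦ P₀₁ ⟧ p q
    vis vx vx _ = visible-refl
    vis vx vy ()
    vis vx vh ()
    vis vx vg ()
    vis vx (va j) _ = via₁ (x~a j)
    vis vx (vb j) ()
    vis vx (vd j) ()
    vis vy vx ()
    vis vy vy _ = visible-refl
    vis vy vh _ = via₄ (λ { (y~d _) (edge ()) }) (λ { (y~d _) (d~b _) (edge ()) ; (y~d _) (d~y _) (edge ()) })
      (y~d zero) (d~b zero) (b~g zero) g~h refl refl refl
    vis vy vg _ = via₃ (λ { (y~d _) (edge ()) }) (y~d zero) (d~b zero) (b~g zero) refl refl
    vis vy (va j) ()
    vis vy (vb j) _ = via₂ (y~d j) (d~b j) refl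
    vis vy (vd j) _ = via₁ (y~d j)
    vis vh vx ()
    vis vh vy _ = via₄ (λ { (h~a _) (edge ()) ; h~g (edge ()) })
      (λ { (h~a _) (a~x _) (edge ()) ; (h~a _) (a~h _) (edge ()) ; (h~a _) (a~b _) (edge ())
         ; h~g (g~b _) (edge ()) ; h~g g~h (edge ()) })
      h~g (g~b zero) (b~d zero) (d~y zero) refl refl refl
    vis vh vh _ = visible-refl
    vis vh vg _ = via₁ h~g
    vis vh (va j) ()
    vis vh (vb j) _ = via₂ h~g (g~b j) refl
    vis vh (vd j) _ = via₃ (λ { (h~a _) (edge ()) ; h~g (edge ()) }) h~g (g~b j) (b~d j) refl refl
    vis vg vx ()
    vis vg vy _ = via₃ (λ { (g~b _) (edge ()) ; g~h (edge ()) }) (g~b zero) (b~d zero) (d~y zero) refl refl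
    vis vg vh _ = via₁ g~h
    vis vg vg _ = visible-refl
    vis vg (va j) ()
    vis vg (vb j) _ = via₁ (g~b j)
    vis vg (vd j) _ = via₂ (g~b j) (b~d j) refl
    vis (va i) vx _ = via₁ (a~x i)
    vis (va i) vy ()
    vis (va i) vh ()
    vis (va i) vg ()
    vis (va i) (va j) _ = via₂ (a~h i) (h~a j) refl
    vis (va i) (vb j) ()
    vis (va i) (vd j) ()
    vis (vb i) vx ()
    vis (vb i) vy _ = via₂ (b~d i) (d~y i) refl
    vis (vb i) vh _ = via₂ (b~g i) g~h refl
    vis (vb i) vg _ = via₁ (b~g i)
    vis (vb i) (va j) ()
    vis (vb i) (vb j) _ = via₂ (b~g i) (g~b j) refl
    vis (vb i) (vd j) _ = via₃ (λ { (b~a _) (edge ()) ; (b~g _) (edge ()) ; (b~d _) (edge ()) })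
        (b~g i) (g~b j) (b~d j) refl refl
    vis (vd i) vx ()
    vis (vd i) vy _ = via₁ (d~y i)
    vis (vd i) vh _ = via₃ (λ { (d~b _) (edge ()) ; (d~y _) (edge ()) }) (d~b i) (b~g i) g~h refl refl
    vis (vd i) vg _ = via₂ (d~b i) (b~g i) refl
    vis (vd i) (va j) ()
    vis (vd i) (vb j) _ = via₃ (λ { (d~b _) (edge ()) ; (d~y _) (edge ()) }) (d~b i) (b~g i) (g~b j) refl refl
    vis (vd i) (vd j) _ = via₂ (d~y i) (y~d j) refl

    module _ {Y : Subset N} (dual : IsDualMV G₀₁ Y) where

      open Bounds dual

      ¬x~y : ¬ vx ~ vy
      ¬x~y (edge ())

      b∉Y : ∀ {i} → enc (vb i) ∉ Y
      b∉Y = d∉Y ¬x~y ∘ b∈Y⇒d∈Y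

      only-h : enc vh ∈ Y → ∀ {p} → enc p ∈ Y → p ≡ vh
      only-h h∈Y {vx} x∈Y = ⊥-elim (x∈Y⇒h∉Y x∈Y h∈Y)
      only-h h∈Y {vy} = ⊥-elim ∘ y∉Y
      only-h h∈Y {vh} _ = refl
      only-h h∈Y {vg} = ⊥-elim ∘ g∉Y
      only-h h∈Y {va _} a∈Y = ⊥-elim (x∈Y⇒h∉Y (a∈Y⇒x∈Y a∈Y b∉Y) h∈Y)
      only-h h∈Y {vb _} = ⊥-elim ∘ b∉Y
      only-h h∈Y {vd _} = ⊥-elim ∘ d∉Y ¬x~y

      only-P₀₁ : enc vh ∉ Y → ∀ {p} → enc p ∈ Y → P₀₁ p ≡ true
      only-P₀₁ h∉Y {vx} _ = refl
      only-P₀₁ h∉Y {vy} = ⊥-elim ∘ y∉Y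
      only-P₀₁ h∉Y {vh} = ⊥-elim ∘ h∉Y
      only-P₀₁ h∉Y {vg} = ⊥-elim ∘ g∉Y
      only-P₀₁ h∉Y {va _} _ = refl
      only-P₀₁ h∉Y {vb _} = ⊥-elim ∘ b∉Y
      only-P₀₁ h∉Y {vd _} = ⊥-elim ∘ d∉Y ¬x~y

      ∣Y∣≤1+k : ∣ Y ∣ ≤ suc k
      ∣Y∣≤1+k with enc vh ∈? Y
      ... | yes h∈Y = ≤-trans (∣∣≤1 (from-dec ∘ members (only-h h∈Y))) (s≤s z≤n)
      ... | no h∉Y = ≤-trans (p⊆q⇒∣p∣≤∣q∣ (Equivalence.from ∈⟦P⟧ ∘ members (only-P₀₁ h∉Y)))
                             (≤-reflexive ∣⟦P₀₁⟧∣)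

    μ-G₀₁ : IsMuD G₀₁ (suc k)
    μ-G₀₁ = (⟦ P₀₁ ⟧ , dualMV vis , ∣⟦P₀₁⟧∣) , λ Y dual → ∣Y∣≤1+k dual

  module G₀₀-Properties where

    open FamilyGraph G₀₀ G₀₀-represents public

    P₀₀ : V → Bool
    P₀₀ vx = true
    P₀₀ _ = false

    open Witness P₀₀

    ∣⟦P₀₀⟧∣ : ∣ ⟦ P₀₀ ⟧ ∣ ≡ 1
    ∣⟦P₀₀⟧∣ = cong suc (∣tabulate-false∣ (λ i → P₀₀ (dec (suc (suc (suc (suc i)))))) λ _ → refl)

    vis : ∀ p q → P₀₀ p ≡ P₀₀ q → Vis ⟦ P₀₀ ⟧ p q
    vis vx vx _ = visible-refl
    vis vx vy ()
    vis vx vh ()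
    vis vx vg ()
    vis vx (va j) ()
    vis vx (vb j) ()
    vis vx (vd j) ()
    vis vy vx ()
    vis vy vy _ = visible-refl
    vis vy vh _ = via₄ (λ { (y~d _) (edge ()) }) (λ { (y~d _) (d~b _) (edge ()) ; (y~d _) (d~y _) (edge ()) })
      (y~d zero) (d~b zero) (b~a zero) (a~h zero) refl refl refl
    vis vy vg _ = via₃ (λ { (y~d _) (edge ()) }) (y~d zero) (d~b zero) (b~g zero) refl refl
    vis vy (va j) _ = via₃ (λ { (y~d _) (edge ()) }) (y~d j) (d~b j) (b~a j) refl refl
    vis vy (vb j) _ = via₂ (y~d j) (d~b j) refl
    vis vy (vd j) _ = via₁ (y~d j)
    vis vh vx ()
    vis vh vy _ = via₄ (λ { (h~a _) (edge ()) })
      (λ { (h~a _) (a~x _) (edge ()) ; (h~a _) (a~h _) (edge ()) ; (h~a _) (a~b _) (edge ()) })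
      (h~a zero) (a~b zero) (b~d zero) (d~y zero) refl refl refl
    vis vh vh _ = visible-refl
    vis vh vg _ = via₃ (λ { (h~a _) (edge ()) }) (h~a zero) (a~b zero) (b~g zero) refl refl
    vis vh (va j) _ = via₁ (h~a j)
    vis vh (vb j) _ = via₂ (h~a j) (a~b j) refl
    vis vh (vd j) _ = via₃ (λ { (h~a _) (edge ()) }) (h~a j) (a~b j) (b~d j) refl refl
    vis vg vx ()
    vis vg vy _ = via₃ (λ { (g~b _) (edge ()) }) (g~b zero) (b~d zero) (d~y zero) refl refl
    vis vg vh _ = via₃ (λ { (g~b _) (edge ()) }) (g~b zero) (b~a zero) (a~h zero) refl refl
    vis vg vg _ = visible-refl
    vis vg (va j) _ = via₂ (g~b j) (b~a j) refl
    vis vg (vb j) _ = via₁ (g~b j)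
    vis vg (vd j) _ = via₂ (g~b j) (b~d j) refl
    vis (va i) vx ()
    vis (va i) vy _ = via₃ (λ { (a~x _) (edge ()) ; (a~h _) (edge ()) ; (a~b _) (edge ()) })
        (a~b i) (b~d i) (d~y i) refl refl
    vis (va i) vh _ = via₁ (a~h i)
    vis (va i) vg _ = via₂ (a~b i) (b~g i) refl
    vis (va i) (va j) _ = via₂ (a~h i) (h~a j) refl
    vis (va i) (vb j) _ = via₃ (λ { (a~x _) (edge ()) ; (a~h _) (edge ()) ; (a~b _) (edge ()) })
        (a~h i) (h~a j) (a~b j) refl refl
    vis (va i) (vd j) _ = via₄ (λ { (a~x _) (edge ()) ; (a~h _) (edge ()) ; (a~b _) (b~d _) → refl })
      (λ { (a~x _) (x~a _) (edge ()) ; (a~h _) (h~a _) (edge ())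
         ; (a~b _) (b~a _) (edge ()) ; (a~b _) (b~g _) (edge ()) ; (a~b _) (b~d _) (edge ()) })
      (a~h i) (h~a j) (a~b j) (b~d j) refl refl refl
    vis (vb i) vx ()
    vis (vb i) vy _ = via₂ (b~d i) (d~y i) refl
    vis (vb i) vh _ = via₂ (b~a i) (a~h i) refl
    vis (vb i) vg _ = via₁ (b~g i)
    vis (vb i) (va j) _ = via₃ (λ { (b~a _) (edge ()) ; (b~g _) (edge ()) ; (b~d _) (edge ()) })
        (b~g i) (g~b j) (b~a j) refl refl
    vis (vb i) (vb j) _ = via₂ (b~g i) (g~b j) refl
    vis (vb i) (vd j) _ = via₃ (λ { (b~a _) (edge ()) ; (b~g _) (edge ()) ; (b~d _) (edge ()) })
        (b~g i) (g~b j) (b~d j) refl refl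
    vis (vd i) vx ()
    vis (vd i) vy _ = via₁ (d~y i)
    vis (vd i) vh _ = via₃ (λ { (d~b _) (edge ()) ; (d~y _) (edge ()) }) (d~b i) (b~a i) (a~h i) refl refl
    vis (vd i) vg _ = via₂ (d~b i) (b~g i) refl
    vis (vd i) (va j) _ = via₄ (λ { (d~b _) (b~a _) → refl ; (d~y _) (edge ()) })
      (λ { (d~b _) (b~a _) (edge ()) ; (d~b _) (b~d _) (edge ()) ; (d~b _) (b~g _) (edge ()) ; (d~y _) (y~d _) (edge ()) })
      (d~b i) (b~a i) (a~h i) (h~a j) refl refl refl
    vis (vd i) (vb j) _ = via₃ (λ { (d~b _) (edge ()) ; (d~y _) (edge ()) }) (d~b i) (b~g i) (g~b j) refl refl
    vis (vd i) (vd j) _ = via₂ (d~y i) (y~d j) refl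

    module _ {Y : Subset N} (dual : IsDualMV G₀₀ Y) where

      open Bounds dual

      ¬x~y : ¬ vx ~ vy
      ¬x~y (edge ())

      ¬h~g : ¬ vh ~ vg
      ¬h~g (edge ())

      b∉Y : ∀ {i} → enc (vb i) ∉ Y
      b∉Y = d∉Y ¬x~y ∘ b∈Y⇒d∈Y

      a∉Y : ∀ {i} → enc (va i) ∉ Y
      a∉Y a∈Y = x∈Y⇒h∉Y (a∈Y⇒x∈Y a∈Y b∉Y) (a∈Y⇒h∈Y ¬h~g a∈Y b∉Y)

      only-x : enc vx ∈ Y → ∀ {p} → enc p ∈ Y → p ≡ vx
      only-x x∈Y {vx} _ = refl
      only-x x∈Y {vy} = ⊥-elim ∘ y∉Y
      only-x x∈Y {vh} = ⊥-elim ∘ x∈Y⇒h∉Y x∈Y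
      only-x x∈Y {vg} = ⊥-elim ∘ g∉Y
      only-x x∈Y {va _} = ⊥-elim ∘ a∉Y
      only-x x∈Y {vb _} = ⊥-elim ∘ b∉Y
      only-x x∈Y {vd _} = ⊥-elim ∘ d∉Y ¬x~y

      only-h : enc vx ∉ Y → ∀ {p} → enc p ∈ Y → p ≡ vh
      only-h x∉Y {vx} = ⊥-elim ∘ x∉Y
      only-h x∉Y {vy} = ⊥-elim ∘ y∉Y
      only-h x∉Y {vh} _ = refl
      only-h x∉Y {vg} = ⊥-elim ∘ g∉Y
      only-h x∉Y {va _} = ⊥-elim ∘ a∉Y
      only-h x∉Y {vb _} = ⊥-elim ∘ b∉Y
      only-h x∉Y {vd _} = ⊥-elim ∘ d∉Y ¬x~y

      ∣Y∣≤1 : ∣ Y ∣ ≤ 1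
      ∣Y∣≤1 with enc vx ∈? Y
      ... | yes x∈Y = ∣∣≤1 (from-dec ∘ members (only-x x∈Y))
      ... | no x∉Y = ∣∣≤1 (from-dec ∘ members (only-h x∉Y))

    μ-G₀₀ : IsMuD G₀₀ 1
    μ-G₀₀ = (⟦ P₀₀ ⟧ , dualMV vis , ∣⟦P₀₀⟧∣) , λ Y dual → ∣Y∣≤1 dual

record EdgeDeletion (m m′ : ℕ) : Set where
  field
    {order} : ℕ
    G : Graph order
    u v : Fin order
    connected : Connected G
    edge-uv : Adj G u v
    connected′ : Connected (removeEdge G u v)
    μ : IsMuD G m
    μ′ : IsMuD (removeEdge G u v) m′

deleting-hg : ∀ t → EdgeDeletion (4 ℕ.+ t) 1
deleting-hg t = record
  { G = G₀₁ ; u = enc vh ; v = enc vg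
  ; connected = G₀₁-Properties.connected ; edge-uv = G₀₁-Properties.adjacent h~g ; connected′ =
    G₀₀-Properties.connected
  ; μ = G₀₁-Properties.μ-G₀₁ ; μ′ = G₀₀-Properties.μ-G₀₀ }
  where open Family t

deleting-xy : ∀ t → EdgeDeletion 2 (4 ℕ.+ t)
deleting-xy t = record
  { G = G₁₁ ; u = enc vx ; v = enc vy
  ; connected = G₁₁-Properties.connected ; edge-uv = G₁₁-Properties.adjacent x~y ; connected′ =
    G₀₁-Properties.connected
  ; μ = G₁₁-Properties.μ-G₁₁ ; μ′ = G₀₁-Properties.μ-G₀₁ }
  where open Family t

module Archimedean where

  open import Data.Nat using (z≤n; s≤s)
  import Data.Nat.Properties as ℕₚ
  open import Data.Integer using (+_; -[1+_]; +<+; -<+)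
  import Data.Integer as ℤ
  import Data.Integer.Properties as ℤₚ
  open import Data.Rational using (ℚ; mkℚ; 0ℚ; _<_; _≤_; _*_; _+_; _-_; -_; 1/_; positive; Positive; NonZero)
  open import Data.Rational.Properties
  open import Data.Rational.Unnormalised using (mkℚᵘ; *<*)
  import Data.Rational.Unnormalised.Properties as ℚᵘ

  archimedean : ∀ c → ∃ λ t → c < ℕtoℚ (4 ℕ.+ t)
  archimedean (mkℚ (+ m) d _) = m , toℚᵘ-cancel-<
    (ℚᵘ.<-respʳ-≃ (ℚᵘ.≃-sym (toℚᵘ-fromℚᵘ (mkℚᵘ (+ (4 ℕ.+ m)) 0)))
      (*<* (subst₂ ℤ._<_ (ℤₚ.pos-* m 1) (ℤₚ.pos-* (4 ℕ.+ m) (suc d)) (+<+ m<[4+m][1+d]))))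
    where
    m<[4+m][1+d] : m ℕ.* 1 ℕ.< (4 ℕ.+ m) ℕ.* suc d
    m<[4+m][1+d] rewrite ℕₚ.*-identityʳ m = ℕₚ.<-≤-trans (ℕₚ.m<n+m m (s≤s z≤n)) (ℕₚ.m≤m*n (4 ℕ.+ m) (suc d))
  archimedean (mkℚ -[1+ _ ] _ _) = 0 , toℚᵘ-cancel-<
    (ℚᵘ.<-respʳ-≃ (ℚᵘ.≃-sym (toℚᵘ-fromℚᵘ (mkℚᵘ (+ 4) 0))) (*<* -<+))

  archimedean-affine : ∀ {a} b c → 0ℚ < a → ∃ λ t → c < a * ℕtoℚ (4 ℕ.+ t) + b
  archimedean-affine {a} b c 0<a = t , (begin-strict
    c                         ≡⟨ sym c-b+b≡c ⟩
    (c - b) + b               ≡⟨ cong (_+ b) (sym a[[c-b]/a]≡c-b) ⟩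
    a * ((c - b) * 1/ a) + b  <⟨ +-monoˡ-< b (*-monoʳ-<-pos a (proj₂ (archimedean ((c - b) * 1/ a)))) ⟩
    a * ℕtoℚ (4 ℕ.+ t) + b    ∎)
    where
    open ≤-Reasoning
    instance
      a-positive : Positive a
      a-positive = positive 0<a
      a-nonZero : NonZero a
      a-nonZero = pos⇒nonZero a
    t : ℕ
    t = proj₁ (archimedean ((c - b) * 1/ a))
    c-b+b≡c : (c - b) + b ≡ c
    c-b+b≡c = trans (+-assoc c (- b) b) (trans (cong (λ z → c + z) (+-inverseˡ b)) (+-identityʳ c))
    a[[c-b]/a]≡c-b : a * ((c - b) * 1/ a) ≡ c - b
    a[[c-b]/a]≡c-b = trans (cong (a *_) (*-comm (c - b) (1/ a)))
      (trans (sym (*-assoc a (1/ a) (c - b))) (trans (cong (_* (c - b)) (*-inverseʳ a)) (*-identityˡ (c - b))))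

  <⇒≱ : ∀ {p q} → p < q → ¬ q ≤ p
  <⇒≱ p<q q≤p = <-irrefl refl (<-≤-trans p<q q≤p)

open Archimedean
open import Data.Rational using (ℚ; 0ℚ; _<_; _≤_; _*_; _+_)

proposition3p5 :
  (¬ Σ ℚ λ a → Σ ℚ λ b → 0ℚ < a ×
      (∀ n (G : Graph n) u v → Connected G → Adj G u v → Connected (removeEdge G u v) →
        ∀ m m′ → IsMuD G m → IsMuD (removeEdge G u v) m′ → a * ℕtoℚ m + b ≤ ℕtoℚ m′))
  ×
  (¬ Σ ℚ λ a → Σ ℚ λ b → 0ℚ < a ×
      (∀ n (G : Graph n) u v → Connected G → Adj G u v → Connected (removeEdge G u v) →
        ∀ m m′ → IsMuD G m → IsMuD (removeEdge G u v) m′ → ℕtoℚ m′ ≤ a * ℕtoℚ m + b))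
proposition3p5 =
  (λ (a , b , 0<a , bound) →
    let t , 1<a[4+t]+b = archimedean-affine b (ℕtoℚ 1) 0<a
        open EdgeDeletion (deleting-hg t)
    in <⇒≱ 1<a[4+t]+b (bound _ G u v connected edge-uv connected′ _ _ μ μ′))
  ,
  (λ (a , b , _ , bound) →
    let t , 2a+b<4+t = archimedean (a * ℕtoℚ 2 + b)
        open EdgeDeletion (deleting-xy t)
    in <⇒≱ 2a+b<4+t (bound _ G u v connected edge-uv connected′ _ _ μ μ′))
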